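{- Let $k$ be a natural number, let $G$ be a multigraph and let $v$ be a vertex of $G$ such that $d_G(v)<2k$ and $p_G(x,y)\geq k$ for any two distinct neighbors $x,y$ of $v$. Then $v$ is not a cut-vertex of $G$.
   Context: A multigraph may have multiple edges but no loops. For vertices $x,y$ of $G$, $p_G(x,y)$ denotes the maximum number of pairwise edge-disjoint paths between $x$ and $y$ in $G$. Natural numbers are positive. -}

module Defs where

open import Data.Nat using (ℕ)
open import Data.Fin using (Fin; _≟_)
open import Data.Product using (_×_; _,_; proj₁; proj₂; ∃)
open import Data.Sum using (_⊎_)
open import Data.List using (List; []; _∷_; length; filter)
open import Data.List.Relation.Unary.Unique.Propositional using (Unique)
open import Data.List.Membership.Propositional using (_∈_)
open import Data.List.Base using () renaming (tabulate to tab)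
open import Relation.Nullary using (¬_; Dec)
open import Relation.Nullary.Decidable using (_⊎-dec_)
open import Relation.Binary.PropositionalEquality using (_≡_; _≢_)
open import Data.Empty using (⊥)

record Multigraph : Set where
  field
    n     : ℕ
    m     : ℕ
    ends  : Fin m → Fin n × Fin n
    loopless : ∀ e → proj₁ (ends e) ≢ proj₂ (ends e)

  Vertex : Set
  Vertex = Fin n

  Edge : Set
  Edge = Fin m

  Joins : Edge → Vertex → Vertex → Set
  Joins e x y = (proj₁ (ends e) ≡ x × proj₂ (ends e) ≡ y)
              ⊎ (proj₁ (ends e) ≡ y × proj₂ (ends e) ≡ x)

  Incident : Edge → Vertex → Set
  Incident e v = proj₁ (ends e) ≡ v ⊎ proj₂ (ends e) ≡ v

  incident? : (v : Vertex) (e : Edge) → Dec (Incident e v)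
  incident? v e = (proj₁ (ends e) ≟ v) ⊎-dec (proj₂ (ends e) ≟ v)

  degree : Vertex → ℕ
  degree v = length (filter (incident? v) (tab (λ e → e)))

  Adjacent : Vertex → Vertex → Set
  Adjacent x y = ∃ λ e → Joins e x y

  data Walk : Vertex → Vertex → Set where
    nil  : ∀ {x} → Walk x x
    cons : ∀ {x z y} (e : Edge) → Joins e x z → Walk z y → Walk x y

  vertices : ∀ {x y} → Walk x y → List Vertex
  vertices {x} nil = x ∷ []
  vertices {x} (cons e _ w) = x ∷ vertices w

  edges : ∀ {x y} → Walk x y → List Edge
  edges nil = []
  edges (cons e _ w) = e ∷ edges w

  IsPath : ∀ {x y} → Walk x y → Set
  IsPath w = Unique (vertices w)

  EdgeDisjoint : ∀ {x y} → Walk x y → Walk x y → Set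
  EdgeDisjoint p q = ∀ e → e ∈ edges p → e ∈ edges q → ⊥

  AtLeastEdgeDisjointPaths : ℕ → Vertex → Vertex → Set
  AtLeastEdgeDisjointPaths k x y =
    ∃ λ (P : Fin k → Walk x y) →
      (∀ i → IsPath (P i)) × (∀ i j → i ≢ j → EdgeDisjoint (P i) (P j))

  -- v is a cut-vertex: G - v has more components than G, i.e. some two
  -- vertices a, b ≠ v are connected in G but every a–b walk meets v.
  IsCutVertex : Vertex → Set
  IsCutVertex v = ∃ λ a → ∃ λ b → a ≢ v × b ≢ v × Walk a b ×
                  (∀ (w : Walk a b) → v ∈ vertices w)

module Submission where

-- Suppose v were a cut-vertex: there are a, b ≠ v and an
-- a–b walk w, yet every a–b walk meets v.  Cutting w at its first visit of v
-- gives a neighbour x of v and an a–x walk avoiding v; cutting it at its last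
-- visit gives a neighbour y and a y–b walk avoiding v.  Hence every x–y walk
-- meets v (otherwise splicing the three walks gives an a–b walk avoiding v);
-- in particular x ≢ y, so by hypothesis there are k pairwise edge-disjoint
-- x–y paths.  Each of them passes through v as an inner vertex, so it uses two
-- distinct edges at v; edge-disjointness makes all these 2k edges distinct,
-- whence d(v) ≥ 2k, contradicting d(v) < 2k.

open import Defs
open import Data.Nat using (ℕ; _<_; _≤_; _*_; _+_)
open import Data.Nat.Properties using (+-identityʳ; ≤⇒≯)
open import Data.Fin using (Fin; splitAt; join; _≟_)
open import Data.Fin.Properties using (injective⇒≤; join-splitAt)
open import Data.Product using (_×_; _,_; ∃; Σ)
open import Data.Sum using (_⊎_; inj₁; inj₂)
open import Data.Empty using (⊥-elim)
open import Data.List using (List; filter; lookup)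
open import Data.List.Base using () renaming (tabulate to tab)
open import Data.List.Membership.Propositional using (_∈_; _∉_)
open import Data.List.Membership.Propositional.Properties using (∈-filter⁺; ∈-tabulate⁺)
open import Data.List.Relation.Unary.Any using (here; there; index)
open import Data.List.Relation.Unary.Any.Properties using (lookup-index)
open import Data.List.Relation.Unary.AllPairs using (_∷_)
import Data.List.Relation.Unary.All as All
import Data.List.Membership.DecPropositional as DecMembership
open import Function.Definitions using (Injective)
open import Relation.Nullary using (¬_; yes; no)
open import Relation.Binary.PropositionalEquality
  using (_≡_; _≢_; refl; sym; trans; cong; subst; module ≡-Reasoning)

module _ (G : Multigraph) where
  open Multigraph G
  open DecMembership (_≟_ {n}) using (_∈?_)

  joins-sym : ∀ {e x y} → Joins e x y → Joins e y x
  joins-sym (inj₁ p) = inj₂ p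
  joins-sym (inj₂ p) = inj₁ p

  joins-incidentˡ : ∀ {e x y} → Joins e x y → Incident e x
  joins-incidentˡ (inj₁ (p , _)) = inj₁ p
  joins-incidentˡ (inj₂ (_ , q)) = inj₂ q

  joins-incidentʳ : ∀ {e x y} → Joins e x y → Incident e y
  joins-incidentʳ j = joins-incidentˡ (joins-sym j)

  joins-backtrack : ∀ {e x z u} → Joins e x z → Joins e z u → x ≡ u
  joins-backtrack {e} (inj₁ (_ , p)) (inj₁ (q , _)) = ⊥-elim (loopless e (trans q (sym p)))
  joins-backtrack     (inj₁ (p , _)) (inj₂ (q , _)) = trans (sym p) q
  joins-backtrack     (inj₂ (_ , p)) (inj₁ (_ , q)) = trans (sym p) q
  joins-backtrack {e} (inj₂ (p , _)) (inj₂ (_ , q)) = ⊥-elim (loopless e (trans p (sym q)))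

  start∈ : ∀ {x y} (w : Walk x y) → x ∈ vertices w
  start∈ nil            = here refl
  start∈ (cons _ _ _)   = here refl

  end∈ : ∀ {x y} (w : Walk x y) → y ∈ vertices w
  end∈ nil              = here refl
  end∈ (cons _ _ w)     = there (end∈ w)

  _++ʷ_ : ∀ {a b c} → Walk a b → Walk b c → Walk a c
  nil        ++ʷ w₂ = w₂
  cons e j w ++ʷ w₂ = cons e j (w ++ʷ w₂)

  ∈-++ʷ : ∀ {a b c u} (w₁ : Walk a b) (w₂ : Walk b c) →
          u ∈ vertices (w₁ ++ʷ w₂) → u ∈ vertices w₁ ⊎ u ∈ vertices w₂
  ∈-++ʷ nil          w₂ p         = inj₂ p
  ∈-++ʷ (cons e j w) w₂ (here p)  = inj₁ (here p)
  ∈-++ʷ (cons e j w) w₂ (there p) with ∈-++ʷ w w₂ p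
  ... | inj₁ q = inj₁ (there q)
  ... | inj₂ q = inj₂ q

  ApproachFrom : Vertex → Vertex → Set
  ApproachFrom v a = ∃ λ x → Adjacent v x × Σ (Walk a x) λ u → v ∉ vertices u

  LeaveTo : Vertex → Vertex → Set
  LeaveTo v b = ∃ λ y → Adjacent v y × Σ (Walk y b) λ u → v ∉ vertices u

  entry : ∀ {a b} v (w : Walk a b) → a ≢ v → v ∈ vertices w → ApproachFrom v a
  entry v nil a≢v (here p) = ⊥-elim (a≢v (sym p))
  entry {a} v (cons {z = z} e j w) a≢v p with z ≟ v | p
  ... | yes refl | _       = a , (e , joins-sym j) , nil , λ { (here q) → a≢v (sym q) }
  ... | no _     | here q  = ⊥-elim (a≢v (sym q))
  ... | no z≢v   | there q with entry v w z≢v q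
  ...   | x , v~x , u , v∉u = x , v~x , cons e j u , λ { (here r) → a≢v (sym r) ; (there r) → v∉u r }

  exit : ∀ {a b} v (w : Walk a b) → b ≢ v → v ∈ vertices w → LeaveTo v b
  exit v nil b≢v (here p) = ⊥-elim (b≢v (sym p))
  exit v (cons {z = z} e j w) b≢v p with v ∈? vertices w | p
  ... | yes q  | _         = exit v w b≢v q
  ... | no v∉w | here refl = z , (e , j) , w , v∉w
  ... | no v∉w | there q   = ⊥-elim (v∉w q)

  SeparatedNeighbours : Vertex → Set
  SeparatedNeighbours v = ∃ λ x → ∃ λ y → Adjacent v x × Adjacent v y ×
    x ≢ v × y ≢ v × x ≢ y × (∀ (q : Walk x y) → v ∈ vertices q)

  -- If v separates a from b, it separates an entry neighbour from an exit
  -- neighbour: an x–y walk avoiding v would splice into an a–b walk avoiding v.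
  cutVertex⇒separatedNeighbours : ∀ v → IsCutVertex v → SeparatedNeighbours v
  cutVertex⇒separatedNeighbours v (a , b , a≢v , b≢v , w , all-meet-v)
    with entry v w a≢v (all-meet-v w) | exit v w b≢v (all-meet-v w)
  ... | x , v~x , u₁ , v∉u₁ | y , v~y , u₂ , v∉u₂ =
    x , y , v~x , v~y , x≢v , y≢v , x≢y , meets
    where
      meets : ∀ (q : Walk x y) → v ∈ vertices q
      meets q with ∈-++ʷ u₁ (q ++ʷ u₂) (all-meet-v (u₁ ++ʷ (q ++ʷ u₂)))
      ... | inj₁ r = ⊥-elim (v∉u₁ r)
      ... | inj₂ r with ∈-++ʷ q u₂ r
      ...   | inj₁ s = s
      ...   | inj₂ s = ⊥-elim (v∉u₂ s)

      x≢v : x ≢ v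
      x≢v refl = v∉u₁ (end∈ u₁)

      y≢v : y ≢ v
      y≢v refl = v∉u₂ (start∈ u₂)

      x≢y : x ≢ y
      x≢y refl with meets nil
      ... | here r = x≢v (sym r)

  record Passage (v : Vertex) {x y : Vertex} (P : Walk x y) : Set where
    field
      enter leave    : Edge
      enter∈P        : enter ∈ edges P
      leave∈P        : leave ∈ edges P
      enter-incident : Incident enter v
      leave-incident : Incident leave v
      enter≢leave    : enter ≢ leave

  -- A path through v with both ends different from v enters and leaves v along
  -- distinct edges (they differ, as the path does not return to its start).
  passage : ∀ {x y} v (P : Walk x y) → IsPath P → v ∈ vertices P → x ≢ v → y ≢ v →
            Passage v P
  passage v nil _ (here p) x≢v _ = ⊥-elim (x≢v (sym p))
  passage v (cons {z = z} e j P) path v∈ x≢v y≢v with z ≟ v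
  passage v (cons e j nil) _ _ _ y≢v | yes refl = ⊥-elim (y≢v refl)
  passage v (cons e j (cons e′ j′ P)) (x∉rest ∷ _) _ _ _ | yes refl = record
    { enter = e ; leave = e′
    ; enter∈P = here refl ; leave∈P = there (here refl)
    ; enter-incident = joins-incidentʳ j ; leave-incident = joins-incidentˡ j′
    ; enter≢leave = λ { refl → All.lookup x∉rest (there (start∈ P)) (joins-backtrack j j′) }
    }
  passage v (cons e j P) (_ ∷ path) v∈ x≢v y≢v | no z≢v with v∈
  ... | here q  = ⊥-elim (x≢v (sym q))
  ... | there q = record
    { enter = enter ; leave = leave
    ; enter∈P = there enter∈P ; leave∈P = there leave∈P
    ; enter-incident = enter-incident ; leave-incident = leave-incident
    ; enter≢leave = enter≢leave
    }
    where open Passage (passage v P path q z≢v y≢v)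

  -- Degree bound: an injective family of N edges at v forces N ≤ d(v), since
  -- positions in the list of edges at v then form an injective Fin N → Fin d(v).
  injective-incident⇒≤degree : ∀ {N} v (f : Fin N → Edge) → Injective _≡_ _≡_ f →
                               (∀ i → Incident (f i) v) → N ≤ degree v
  injective-incident⇒≤degree v f f-inj incident = injective⇒≤ position-injective
    where
      at-v : List Edge
      at-v = filter (incident? v) (tab (λ e → e))

      at-v∋ : ∀ i → f i ∈ at-v
      at-v∋ i = ∈-filter⁺ (incident? v) (∈-tabulate⁺ (f i)) (incident i)

      position-injective : Injective _≡_ _≡_ (λ i → index (at-v∋ i))
      position-injective {i} {j} eq = f-inj (begin
        f i                            ≡⟨ lookup-index (at-v∋ i) ⟩
        lookup at-v (index (at-v∋ i))  ≡⟨ cong (lookup at-v) eq ⟩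
        lookup at-v (index (at-v∋ j))  ≡⟨ sym (lookup-index (at-v∋ j)) ⟩
        f j                            ∎)
        where open ≡-Reasoning

  -- k pairwise edge-disjoint walks, each with a passage through v, give 2k
  -- distinct edges at v: an edge lies on at most one of the walks.
  disjoint-passages⇒≤degree : ∀ {k x y} v (P : Fin k → Walk x y) →
    (∀ i j → i ≢ j → EdgeDisjoint (P i) (P j)) → (∀ i → Passage v (P i)) →
    k + k ≤ degree v
  disjoint-passages⇒≤degree {k} v P disjoint pass =
    injective-incident⇒≤degree v (edge∘split) edge∘split-injective incident
    where
      open Passage

      owner-unique : ∀ {e i j} → e ∈ edges (P i) → e ∈ edges (P j) → i ≡ j
      owner-unique {e} {i} {j} e∈i e∈j with i ≟ j
      ... | yes i≡j = i≡j
      ... | no i≢j  = ⊥-elim (disjoint i j i≢j e e∈i e∈j)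

      edge : Fin k ⊎ Fin k → Edge
      edge (inj₁ i) = enter (pass i)
      edge (inj₂ i) = leave (pass i)

      edge-injective : Injective _≡_ _≡_ edge
      edge-injective {inj₁ i} {inj₁ j} eq =
        cong inj₁ (owner-unique (enter∈P (pass i)) (subst (_∈ edges (P j)) (sym eq) (enter∈P (pass j))))
      edge-injective {inj₂ i} {inj₂ j} eq =
        cong inj₂ (owner-unique (leave∈P (pass i)) (subst (_∈ edges (P j)) (sym eq) (leave∈P (pass j))))
      edge-injective {inj₁ i} {inj₂ j} eq
        with owner-unique (enter∈P (pass i)) (subst (_∈ edges (P j)) (sym eq) (leave∈P (pass j)))
      ... | refl = ⊥-elim (enter≢leave (pass i) eq)
      edge-injective {inj₂ i} {inj₁ j} eq
        with owner-unique (leave∈P (pass i)) (subst (_∈ edges (P j)) (sym eq) (enter∈P (pass j)))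
      ... | refl = ⊥-elim (enter≢leave (pass i) (sym eq))

      edge∘split : Fin (k + k) → Edge
      edge∘split i = edge (splitAt k i)

      edge∘split-injective : Injective _≡_ _≡_ edge∘split
      edge∘split-injective {i} {j} eq = begin
        i                       ≡⟨ sym (join-splitAt k k i) ⟩
        join k k (splitAt k i)  ≡⟨ cong (join k k) (edge-injective {splitAt k i} {splitAt k j} eq) ⟩
        join k k (splitAt k j)  ≡⟨ join-splitAt k k j ⟩
        j                       ∎
        where open ≡-Reasoning

      incident : ∀ i → Incident (edge∘split i) v
      incident i with splitAt k i
      ... | inj₁ j = enter-incident (pass j)
      ... | inj₂ j = leave-incident (pass j)

lemma2p3 : (k : ℕ) → 1 ≤ k → (G : Multigraph) → (v : Multigraph.Vertex G) →
           Multigraph.degree G v < 2 * k →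
           (∀ x y → Multigraph.Adjacent G v x → Multigraph.Adjacent G v y → x ≢ y →
             Multigraph.AtLeastEdgeDisjointPaths G k x y) →
           ¬ Multigraph.IsCutVertex G v
lemma2p3 k _ G v d<2k many-paths cut
  with cutVertex⇒separatedNeighbours G v cut
... | x , y , v~x , v~y , x≢v , y≢v , x≢y , meets
  with many-paths x y v~x v~y x≢y
... | P , paths , disjoint = ≤⇒≯ 2k≤d d<2k
  where
    2k≤d : 2 * k ≤ Multigraph.degree G v
    2k≤d = subst (λ t → k + t ≤ Multigraph.degree G v) (sym (+-identityʳ k))
             (disjoint-passages⇒≤degree G v P disjoint
               (λ i → passage G v (P i) (paths i) (meets (P i)) x≢v y≢v))
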